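{- Let $A\in\mathbb{R}^{n\times m}$ and $j,k\in\mathbb{N}$. A closed walk $W$ on $\Gamma_A$ of length $2jk$ is $2k$-repeating if and only if there does not exist a cycle $L$ in $G_{(AA^{\mathrm t})^k}$ such that $W=\pi(L)$.
   Context: $\Gamma_A$ is the bipartite graph with vertices $X_1,\dots,X_n,Y_1,\dots,Y_m$ and an edge $X_iY_j$ iff $A_{ij}\neq0$. The digraph $G_{(AA^{\mathrm t})^k}$ has vertex set $V_0\cup\dots\cup V_{2k-1}$ with $V_i=\{x^{(i)}_1,\dots,x^{(i)}_n\}$ for $i$ even and $V_i=\{y^{(i)}_1,\dots,y^{(i)}_m\}$ for $i$ odd; for $i$ even there is an edge $x^{(i)}_p\to y^{(i+1)}_q$ iff $A_{pq}\ne0$, and for $i$ odd an edge $y^{(i)}_q\to x^{(i+1\bmod 2k)}_p$ iff $A_{pq}\ne0$. The projection $\pi$ sends $x^{(i)}_p\mapsto X_p$, $y^{(i)}_q\mapsto Y_q$, and edges to the corresponding edges of $\Gamma_A$; it is applied to walks vertex by vertex. A walk is an alternating sequence of vertices and edges, each edge preceded and followed by its endpoints (for a digraph, start then end); its length is the number of edges; it is closed if first and last vertex coincide, and closed walks differing only in choice of starting vertex are identified. A cycle is a closed walk with no repeated vertex other than the start/end. A closed walk $(v_0,v_1,\dots,v_r=v_0)$ is $2k$-repeating if there exist indices $0\le t<t'\le r-1$ with $t\equiv t'\pmod{2k}$ and $v_t=v_{t'}$ (equivalently, it has a closed subwalk, distinct from itself, of length a positive multiple of $2k$). -}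

module Defs where

open import Data.Nat using (ℕ; zero; suc; _+_; _*_)
open import Data.Nat.DivMod using (_mod_)
open import Data.Fin using (Fin; toℕ) renaming (_<_ to _<ᶠ_)
open import Data.Sum using (_⊎_; inj₁; inj₂)
open import Data.Product using (Σ; ∃; _×_)
open import Data.Product using () renaming (_,_ to _,ₚ_)
open import Data.Empty using (⊥)
open import Relation.Nullary using (¬_)
open import Relation.Binary.PropositionalEquality using (_≡_)

-- Generic closed walks (graphs without parallel edges, so a walk is
-- determined by its vertex sequence).
-- A closed walk (v₀,…,v_r = v₀) of length r is stored as the vertex
-- sequence v₀,…,v_{r-1} : Fin r → V, indices read cyclically mod r.

cyc : ∀ {r} → Fin r → Fin r
cyc {suc r} i = suc (toℕ i) mod suc r

rot : ∀ {r} → Fin r → Fin r → Fin r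
rot {suc r} s i = (toℕ i + toℕ s) mod suc r

record ClosedWalk {V : Set} (E : V → V → Set) (r : ℕ) : Set where
  constructor _,_
  field
    vtx  : Fin r → V
    edge : ∀ (i : Fin r) → E (vtx i) (vtx (cyc i))
open ClosedWalk public

IsCycle : {V : Set} {E : V → V → Set} {r : ℕ} → ClosedWalk E r → Set
IsCycle {r = r} (w , _) = ∀ (t t' : Fin r) → w t ≡ w t' → t ≡ t'

Repeating : {V : Set} {E : V → V → Set} {r : ℕ} → ℕ → ClosedWalk E r → Set
Repeating {r = r} d (w , _) =
  ∃ λ (t : Fin r) → ∃ λ (t' : Fin r) →
    (t <ᶠ t') × (∃ λ c → toℕ t' ≡ toℕ t + c * d) × (w t ≡ w t')

SameClosedWalkVia : {V U : Set} {E : V → V → Set} {F : U → U → Set} {r : ℕ} →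
  (V → U) → ClosedWalk E r → ClosedWalk F r → Set
SameClosedWalkVia {r = r} f (l , _) (w , _) =
  ∃ λ (s : Fin r) → ∀ (i : Fin r) → f (l i) ≡ w (rot s i)

-- The matrix A : Fin n → Fin m → R over a type R with zero 0R
-- (only the zero pattern of A matters).

module _ {R : Set} (0R : R) {n m : ℕ} (A : Fin n → Fin m → R) where

  -- vertices of Γ_A : X_p = inj₁ p, Y_q = inj₂ q
  ΓVertex : Set
  ΓVertex = Fin n ⊎ Fin m

  ΓEdge : ΓVertex → ΓVertex → Set
  ΓEdge (inj₁ p) (inj₂ q) = ¬ (A p q ≡ 0R)
  ΓEdge (inj₂ q) (inj₁ p) = ¬ (A p q ≡ 0R)
  ΓEdge (inj₁ _) (inj₁ _) = ⊥
  ΓEdge (inj₂ _) (inj₂ _) = ⊥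

  -- vertices of layer V_i : x-vertices for i even, y-vertices for i odd
  Layer : ℕ → Set
  Layer zero = Fin n
  Layer (suc zero) = Fin m
  Layer (suc (suc i)) = Layer i

  projL : (i : ℕ) → Layer i → ΓVertex
  projL zero p = inj₁ p
  projL (suc zero) q = inj₂ q
  projL (suc (suc i)) v = projL i v

  -- vertices of G_{(AA^t)^k} : V_0 ∪ … ∪ V_{2k-1}
  GVertex : ℕ → Set
  GVertex k = Σ (Fin (2 * k)) λ i → Layer (toℕ i)

  π : (k : ℕ) → GVertex k → ΓVertex
  π k (i ,ₚ v) = projL (toℕ i) v

  GEdge : (k : ℕ) → GVertex k → GVertex k → Set
  GEdge k (i ,ₚ u) (i' ,ₚ v) = (i' ≡ cyc i) × ΓEdge (projL (toℕ i) u) (projL (toℕ i') v)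

-- A vertex of G_{(AA^t)^k} is determined by its layer and its projection to Γ_A, and along
-- any walk in G the layer advances by one modulo 2k.  So if a cycle L projects onto W, a
-- 2k-repetition of W would make L visit the same vertex twice.  Conversely, W can always be
-- lifted, starting in layer 0 or 1 according to the side of its first vertex; the lift closes
-- up because 2k divides the length 2jk, and if W does not 2k-repeat it is a cycle.  Since
-- repetition is decidable, this yields the equivalence constructively.

module Submission where

open import Defs
open import Data.Nat using (ℕ; zero; suc; _+_; _*_; _∸_; _≤_; z≤n; s≤s; NonZero; _%_; _/_)
open import Data.Nat.Properties
  using (+-comm; +-assoc; +-suc; +-identityʳ; <⇒≤; <-irrefl; m+[n∸m]≡n; m+n∸m≡n; m∸n+n≡m;
         [m+n]∸[m+o]≡n∸o; *-distribʳ-∸)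
open import Data.Nat.DivMod
open import Data.Nat.Divisibility using (_∣_; divides; _∣?_; ∣-refl; m∣m*n; *-pres-∣)
open import Data.Fin using (Fin; toℕ; zero) renaming (_<_ to _<ᶠ_)
open import Data.Fin.Properties using (toℕ-injective; toℕ-fromℕ<; toℕ<n; <-cmp; _<?_; _≟_; any?)
open import Data.Sum using (inj₁; inj₂)
open import Data.Sum.Properties using (≡-dec)
open import Data.Product using (Σ; ∃; _×_; _,_; proj₁; proj₂)
open import Data.Empty using (⊥-elim)
open import Function using (_∘_)
open import Function.Bundles using (_⇔_; mk⇔)
open import Relation.Binary using (tri<; tri≈; tri>)
open import Relation.Binary.Definitions using (DecidableEquality)
open import Relation.Binary.PropositionalEquality
open import Relation.Nullary using (¬_; Dec)
open import Relation.Nullary.Decidable using (map′; _×-dec_; decidable-stable)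

[m+n%d]%d≡[m+n]%d : ∀ m n d .{{_ : NonZero d}} → (m + n % d) % d ≡ (m + n) % d
[m+n%d]%d≡[m+n]%d m n d = begin
  (m + n % d) % d          ≡⟨ %-distribˡ-+ m (n % d) d ⟩
  (m % d + n % d % d) % d  ≡⟨ cong (λ x → (m % d + x) % d) (m%n%n≡m%n n d) ⟩
  (m % d + n % d) % d      ≡⟨ sym (%-distribˡ-+ m n d) ⟩
  (m + n) % d              ∎
  where open ≡-Reasoning

[m%d+n]%d≡[m+n]%d : ∀ m n d .{{_ : NonZero d}} → (m % d + n) % d ≡ (m + n) % d
[m%d+n]%d≡[m+n]%d m n d = begin
  (m % d + n) % d  ≡⟨ cong (_% d) (+-comm (m % d) n) ⟩
  (n + m % d) % d  ≡⟨ [m+n%d]%d≡[m+n]%d n m d ⟩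
  (n + m) % d      ≡⟨ cong (_% d) (+-comm n m) ⟩
  (m + n) % d      ∎
  where open ≡-Reasoning

%-≡⇒∣∸ : ∀ {a b} d .{{_ : NonZero d}} → a % d ≡ b % d → d ∣ b ∸ a
%-≡⇒∣∸ {a} {b} d eq = divides (b / d ∸ a / d) (begin
  b ∸ a                                      ≡⟨ cong₂ _∸_ (m≡m%n+[m/n]*n b d) (m≡m%n+[m/n]*n a d) ⟩
  (b % d + b / d * d) ∸ (a % d + a / d * d)  ≡⟨ cong (λ x → (b % d + b / d * d) ∸ (x + a / d * d)) eq ⟩
  (b % d + b / d * d) ∸ (b % d + a / d * d)  ≡⟨ [m+n]∸[m+o]≡n∸o (b % d) _ _ ⟩
  b / d * d ∸ a / d * d                      ≡⟨ sym (*-distribʳ-∸ d (b / d) (a / d)) ⟩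
  (b / d ∸ a / d) * d                        ∎)
  where open ≡-Reasoning

∣∸⇒∃-multiple : ∀ {m n d} → m ≤ n → d ∣ n ∸ m → ∃ λ c → n ≡ m + c * d
∣∸⇒∃-multiple {m} m≤n (divides c eq) = c , trans (sym (m+[n∸m]≡n m≤n)) (cong (m +_) eq)

∃-multiple⇒∣∸ : ∀ {m n d} → (∃ λ c → n ≡ m + c * d) → d ∣ n ∸ m
∃-multiple⇒∣∸ {m} {d = d} (c , refl) = divides c (m+n∸m≡n m (c * d))

toℕ-mod : ∀ a d .{{_ : NonZero d}} → toℕ (a mod d) ≡ a % d
toℕ-mod a d = toℕ-fromℕ< (m%n<n a d)

mod-cong : ∀ a b d .{{_ : NonZero d}} → a % d ≡ b % d → a mod d ≡ b mod d
mod-cong a b d eq = toℕ-injective (trans (toℕ-mod a d) (trans eq (sym (toℕ-mod b d))))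

toℕ-mod≡id : ∀ {d} .{{_ : NonZero d}} (i : Fin d) → toℕ i mod d ≡ i
toℕ-mod≡id {d} i = toℕ-injective (trans (toℕ-mod (toℕ i) d) (m<n⇒m%n≡m (toℕ<n i)))

toℕ-cyc : ∀ {r} (i : Fin (suc r)) → toℕ (cyc i) ≡ suc (toℕ i) % suc r
toℕ-cyc {r} i = toℕ-mod (suc (toℕ i)) (suc r)

cyc-mod : ∀ {r} a → cyc (a mod suc r) ≡ suc a mod suc r
cyc-mod {r} a = mod-cong (suc (toℕ (a mod suc r))) (suc a) (suc r)
  (trans (cong (λ x → suc x % suc r) (toℕ-mod a (suc r))) ([m+n%d]%d≡[m+n]%d 1 a (suc r)))

rot-mod : ∀ {r} (s : Fin (suc r)) a → rot s (a mod suc r) ≡ (a + toℕ s) mod suc r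
rot-mod {r} s a = mod-cong (toℕ (a mod suc r) + toℕ s) (a + toℕ s) (suc r)
  (trans (cong (λ x → (x + toℕ s) % suc r) (toℕ-mod a (suc r)))
         ([m%d+n]%d≡[m+n]%d a (toℕ s) (suc r)))

-- Going back by s is going forward by r ∸ s, which avoids truncated subtraction.
unrot : ∀ {r} → Fin (suc r) → Fin (suc r) → ℕ
unrot {r} s t = toℕ t + (suc r ∸ toℕ s)

unrot-+ : ∀ {r} (s t : Fin (suc r)) → (unrot s t + toℕ s) % suc r ≡ toℕ t
unrot-+ {r} s t = begin
  (toℕ t + (suc r ∸ toℕ s) + toℕ s) % suc r  ≡⟨ cong (_% suc r) (+-assoc (toℕ t) _ (toℕ s)) ⟩
  (toℕ t + (suc r ∸ toℕ s + toℕ s)) % suc r  ≡⟨ cong (λ x → (toℕ t + x) % suc r) (m∸n+n≡m (<⇒≤ (toℕ<n s))) ⟩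
  (toℕ t + suc r) % suc r                    ≡⟨ [m+n]%n≡m%n (toℕ t) (suc r) ⟩
  toℕ t % suc r                              ≡⟨ m<n⇒m%n≡m (toℕ<n t) ⟩
  toℕ t                                      ∎
  where open ≡-Reasoning

unrot-injective : ∀ {r} (s : Fin (suc r)) {t t'} →
  unrot s t % suc r ≡ unrot s t' % suc r → toℕ t ≡ toℕ t'
unrot-injective {r} s {t} {t'} eq = begin
  toℕ t                                ≡⟨ sym (unrot-+ s t) ⟩
  (unrot s t + toℕ s) % suc r          ≡⟨ sym ([m%d+n]%d≡[m+n]%d (unrot s t) (toℕ s) (suc r)) ⟩
  (unrot s t % suc r + toℕ s) % suc r  ≡⟨ cong (λ x → (x + toℕ s) % suc r) eq ⟩
  (unrot s t' % suc r + toℕ s) % suc r ≡⟨ [m%d+n]%d≡[m+n]%d (unrot s t') (toℕ s) (suc r) ⟩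
  (unrot s t' + toℕ s) % suc r         ≡⟨ unrot-+ s t' ⟩
  toℕ t'                               ∎
  where open ≡-Reasoning

module _ {V : Set} {E : V → V → Set} {r : ℕ} where

  vtxAt : ClosedWalk E (suc r) → ℕ → V
  vtxAt W a = vtx W (a mod suc r)

  vtxAt-edge : (W : ClosedWalk E (suc r)) → ∀ a → E (vtxAt W a) (vtxAt W (suc a))
  vtxAt-edge W a = subst (E (vtxAt W a) ∘ vtx W) (cyc-mod a) (edge W (a mod suc r))

  vtxAt-toℕ : (W : ClosedWalk E (suc r)) (i : Fin (suc r)) → vtxAt W (toℕ i) ≡ vtx W i
  vtxAt-toℕ W i = cong (vtx W) (toℕ-mod≡id i)

  vtxAt-% : (W : ClosedWalk E (suc r)) → ∀ a → vtxAt W (a % suc r) ≡ vtxAt W a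
  vtxAt-% W a = cong (vtx W) (mod-cong (a % suc r) a (suc r) (m%n%n≡m%n a (suc r)))

  isCycle⇒vtxAt-injective : (W : ClosedWalk E (suc r)) → IsCycle W →
    ∀ {a b} → vtxAt W a ≡ vtxAt W b → a % suc r ≡ b % suc r
  isCycle⇒vtxAt-injective W cycle {a} {b} eq =
    trans (sym (toℕ-mod a (suc r))) (trans (cong toℕ (cycle _ _ eq)) (toℕ-mod b (suc r)))

  periodicWalk : (f : ℕ → V) → (∀ a → E (f a) (f (suc a))) → (∀ a → f (a % suc r) ≡ f a) →
    ClosedWalk E (suc r)
  periodicWalk f step periodic = (λ i → f (toℕ i)) , λ i →
    subst (E (f (toℕ i))) (sym (trans (cong f (toℕ-cyc i)) (periodic (suc (toℕ i))))) (step (toℕ i))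

sameVia-unrot : ∀ {U V : Set} {F : U → U → Set} {E : V → V → Set} {r} (f : U → V)
  (L : ClosedWalk F (suc r)) (W : ClosedWalk E (suc r)) (s : Fin (suc r)) →
  (∀ i → f (vtx L i) ≡ vtx W (rot s i)) →
  ∀ t → f (vtxAt L (unrot s t)) ≡ vtx W t
sameVia-unrot {r = r} f L W s same t = begin
  f (vtxAt L (unrot s t))               ≡⟨ same (unrot s t mod suc r) ⟩
  vtx W (rot s (unrot s t mod suc r))   ≡⟨ cong (vtx W) (rot-mod s (unrot s t)) ⟩
  vtx W ((unrot s t + toℕ s) mod suc r) ≡⟨ cong (vtx W) (toℕ-injective
                                              (trans (toℕ-mod (unrot s t + toℕ s) (suc r)) (unrot-+ s t))) ⟩
  vtx W t                               ∎
  where open ≡-Reasoning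

repeating? : ∀ {V : Set} {E : V → V → Set} {r} → DecidableEquality V →
  (d : ℕ) (W : ClosedWalk E r) → Dec (Repeating d W)
repeating? _≟_ d W = map′
  (λ (t , t' , t<t' , d∣ , eq) → t , t' , t<t' , ∣∸⇒∃-multiple (<⇒≤ t<t') d∣ , eq)
  (λ (t , t' , t<t' , mult , eq) → t , t' , t<t' , ∃-multiple⇒∣∸ mult , eq)
  (any? λ t → any? λ t' → (t <? t') ×-dec (d ∣? toℕ t' ∸ toℕ t) ×-dec (vtx W t ≟ vtx W t'))

module _ {R : Set} (0R : R) {n m : ℕ} (A : Fin n → Fin m → R) where

  side : ΓVertex 0R A → ℕ
  side (inj₁ _) = 0
  side (inj₂ _) = 1

  side%2 : ∀ x → side x % 2 ≡ side x
  side%2 (inj₁ _) = refl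
  side%2 (inj₂ _) = refl

  side-edge : ∀ {x y} → ΓEdge 0R A x y → side y ≡ suc (side x) % 2
  side-edge {inj₁ _} {inj₂ _} _ = refl
  side-edge {inj₂ _} {inj₁ _} _ = refl

  side-alternates : (f : ℕ → ΓVertex 0R A) → (∀ a → ΓEdge 0R A (f a) (f (suc a))) →
    ∀ a → side (f a) ≡ (side (f 0) + a) % 2
  side-alternates f step zero = sym (trans (cong (_% 2) (+-identityʳ (side (f 0)))) (side%2 (f 0)))
  side-alternates f step (suc a) = begin
    side (f (suc a))                ≡⟨ side-edge (step a) ⟩
    suc (side (f a)) % 2            ≡⟨ cong (λ x → suc x % 2) (side-alternates f step a) ⟩
    suc ((side (f 0) + a) % 2) % 2  ≡⟨ [m+n%d]%d≡[m+n]%d 1 (side (f 0) + a) 2 ⟩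
    suc (side (f 0) + a) % 2        ≡⟨ cong (_% 2) (sym (+-suc (side (f 0)) a)) ⟩
    (side (f 0) + suc a) % 2        ∎
    where open ≡-Reasoning

  projL-injective : ∀ ℓ {u v} → projL 0R A ℓ u ≡ projL 0R A ℓ v → u ≡ v
  projL-injective zero refl = refl
  projL-injective (suc zero) refl = refl
  projL-injective (suc (suc ℓ)) eq = projL-injective ℓ eq

  liftToLayer : ∀ ℓ x → ℓ % 2 ≡ side x → Σ (Layer 0R A ℓ) λ v → projL 0R A ℓ v ≡ x
  liftToLayer zero (inj₁ p) _ = p , refl
  liftToLayer (suc zero) (inj₂ q) _ = q , refl
  liftToLayer (suc (suc ℓ)) x eq = liftToLayer ℓ x eq

  GVertex-≡ : ∀ {k} (u v : GVertex 0R A k) → proj₁ u ≡ proj₁ v → π 0R A k u ≡ π 0R A k v → u ≡ v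
  GVertex-≡ (i , _) (.i , _) refl eq = cong (i ,_) (projL-injective (toℕ i) eq)

  layer-vtxAt : ∀ {k r} (L : ClosedWalk (GEdge 0R A (suc k)) (suc r)) →
    ∀ a → proj₁ (vtxAt L a) ≡ (toℕ (proj₁ (vtxAt L 0)) + a) mod (2 * suc k)
  layer-vtxAt {k} L zero =
    sym (trans (cong (λ x → x mod (2 * suc k)) (+-identityʳ (toℕ (proj₁ (vtxAt L 0)))))
               (toℕ-mod≡id (proj₁ (vtxAt L 0))))
  layer-vtxAt {k} L (suc a) = begin
    proj₁ (vtxAt L (suc a))    ≡⟨ proj₁ (vtxAt-edge L a) ⟩
    cyc (proj₁ (vtxAt L a))    ≡⟨ cong cyc (layer-vtxAt L a) ⟩
    cyc ((x₀ + a) mod K)       ≡⟨ cyc-mod (x₀ + a) ⟩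
    suc (x₀ + a) mod K         ≡⟨ cong (λ x → x mod K) (sym (+-suc x₀ a)) ⟩
    (x₀ + suc a) mod K         ∎
    where
      open ≡-Reasoning
      K = 2 * suc k
      x₀ = toℕ (proj₁ (vtxAt L 0))

  isCycle⇒¬repeating : ∀ {k r} (W : ClosedWalk (ΓEdge 0R A) (suc r))
    (L : ClosedWalk (GEdge 0R A (suc k)) (suc r)) → IsCycle L →
    SameClosedWalkVia (π 0R A (suc k)) L W → ¬ Repeating (2 * suc k) W
  isCycle⇒¬repeating {k} {r} W L cycle (s , same) (t , t' , t<t' , (c , t'≡) , vtx-eq) =
    <-irrefl (unrot-injective s (isCycle⇒vtxAt-injective L cycle {a} {a'} same-vertex)) t<t'
    where
      K = 2 * suc k
      a = unrot s t
      a' = unrot s t'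
      x₀ = toℕ (proj₁ (vtxAt L 0))
      a'≡ : a' ≡ a + c * K
      a'≡ = begin
        toℕ t' + (suc r ∸ toℕ s)          ≡⟨ cong (_+ (suc r ∸ toℕ s)) t'≡ ⟩
        toℕ t + c * K + (suc r ∸ toℕ s)   ≡⟨ +-assoc (toℕ t) (c * K) _ ⟩
        toℕ t + (c * K + (suc r ∸ toℕ s)) ≡⟨ cong (toℕ t +_) (+-comm (c * K) _) ⟩
        toℕ t + ((suc r ∸ toℕ s) + c * K) ≡⟨ sym (+-assoc (toℕ t) _ (c * K)) ⟩
        a + c * K                         ∎
        where open ≡-Reasoning
      same-layer : proj₁ (vtxAt L a) ≡ proj₁ (vtxAt L a')
      same-layer = begin
        proj₁ (vtxAt L a)       ≡⟨ layer-vtxAt {k} L a ⟩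
        (x₀ + a) mod K          ≡⟨ mod-cong (x₀ + a) (x₀ + a') K same-% ⟩
        (x₀ + a') mod K         ≡⟨ sym (layer-vtxAt {k} L a') ⟩
        proj₁ (vtxAt L a')      ∎
        where
          open ≡-Reasoning
          same-% : (x₀ + a) % K ≡ (x₀ + a') % K
          same-% = begin
            (x₀ + a) % K            ≡⟨ sym ([m+kn]%n≡m%n (x₀ + a) c K) ⟩
            (x₀ + a + c * K) % K    ≡⟨ cong (_% K) (+-assoc x₀ a (c * K)) ⟩
            (x₀ + (a + c * K)) % K  ≡⟨ cong (λ x → (x₀ + x) % K) (sym a'≡) ⟩
            (x₀ + a') % K           ∎
      same-vertex : vtxAt L a ≡ vtxAt L a'
      same-vertex = GVertex-≡ {suc k} _ _ same-layer
        (trans (sameVia-unrot (π 0R A (suc k)) L W s same t)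
               (trans vtx-eq (sym (sameVia-unrot (π 0R A (suc k)) L W s same t'))))

  module Lift {k r} (K∣r : 2 * suc k ∣ suc r) (W : ClosedWalk (ΓEdge 0R A) (suc r)) where

    private
      K = 2 * suc k
      s₀ = side (vtxAt W 0)

    layerAt : ℕ → Fin K
    layerAt a = (s₀ + a) mod K

    layerAt-parity : ∀ a → toℕ (layerAt a) % 2 ≡ side (vtxAt W a)
    layerAt-parity a = begin
      toℕ (layerAt a) % 2  ≡⟨ cong (_% 2) (toℕ-mod (s₀ + a) K) ⟩
      (s₀ + a) % K % 2     ≡⟨ m∣n⇒o%n%m≡o%m 2 K (s₀ + a) (m∣m*n {2} (suc k)) ⟩
      (s₀ + a) % 2         ≡⟨ sym (side-alternates (vtxAt W) (vtxAt-edge W) a) ⟩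
      side (vtxAt W a)     ∎
      where open ≡-Reasoning

    liftAt : ℕ → GVertex 0R A (suc k)
    liftAt a = layerAt a , proj₁ (liftToLayer (toℕ (layerAt a)) (vtxAt W a) (layerAt-parity a))

    π-liftAt : ∀ a → π 0R A (suc k) (liftAt a) ≡ vtxAt W a
    π-liftAt a = proj₂ (liftToLayer (toℕ (layerAt a)) (vtxAt W a) (layerAt-parity a))

    liftAt-edge : ∀ a → GEdge 0R A (suc k) (liftAt a) (liftAt (suc a))
    liftAt-edge a =
      trans (cong (λ x → x mod K) (+-suc s₀ a)) (sym (cyc-mod (s₀ + a))) ,
      subst₂ (ΓEdge 0R A) (sym (π-liftAt a)) (sym (π-liftAt (suc a))) (vtxAt-edge W a)

    liftAt-periodic : ∀ a → liftAt (a % suc r) ≡ liftAt a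
    liftAt-periodic a = GVertex-≡ {suc k} _ _
      (mod-cong (s₀ + a % suc r) (s₀ + a) K (begin
        (s₀ + a % suc r) % K      ≡⟨ sym ([m+n%d]%d≡[m+n]%d s₀ (a % suc r) K) ⟩
        (s₀ + a % suc r % K) % K  ≡⟨ cong (λ x → (s₀ + x) % K) (m∣n⇒o%n%m≡o%m K (suc r) a K∣r) ⟩
        (s₀ + a % K) % K          ≡⟨ [m+n%d]%d≡[m+n]%d s₀ a K ⟩
        (s₀ + a) % K              ∎))
      (trans (π-liftAt (a % suc r)) (trans (vtxAt-% W a) (sym (π-liftAt a))))
      where open ≡-Reasoning

    liftWalk : ClosedWalk (GEdge 0R A (suc k)) (suc r)
    liftWalk = periodicWalk liftAt liftAt-edge liftAt-periodic

    liftWalk-same : SameClosedWalkVia (π 0R A (suc k)) liftWalk W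
    liftWalk-same = zero , λ i →
      trans (π-liftAt (toℕ i)) (cong (vtxAt W) (sym (+-identityʳ (toℕ i))))

    liftAt-repeats : ∀ {i i' : Fin (suc r)} → i <ᶠ i' → liftAt (toℕ i) ≡ liftAt (toℕ i') →
      Repeating K W
    liftAt-repeats {i} {i'} i<i' eq =
      i , i' , i<i' , ∣∸⇒∃-multiple (<⇒≤ i<i') K∣i'∸i , same-vtx
      where
        open ≡-Reasoning
        same-% : (s₀ + toℕ i) % K ≡ (s₀ + toℕ i') % K
        same-% = trans (sym (toℕ-mod (s₀ + toℕ i) K))
                       (trans (cong (toℕ ∘ proj₁) eq) (toℕ-mod (s₀ + toℕ i') K))
        K∣i'∸i : K ∣ toℕ i' ∸ toℕ i
        K∣i'∸i = subst (K ∣_) ([m+n]∸[m+o]≡n∸o s₀ (toℕ i') (toℕ i))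
                       (%-≡⇒∣∸ {s₀ + toℕ i} {s₀ + toℕ i'} K same-%)
        same-vtx : vtx W i ≡ vtx W i'
        same-vtx = begin
          vtx W i                          ≡⟨ sym (vtxAt-toℕ W i) ⟩
          vtxAt W (toℕ i)                  ≡⟨ sym (π-liftAt (toℕ i)) ⟩
          π 0R A (suc k) (liftAt (toℕ i))  ≡⟨ cong (π 0R A (suc k)) eq ⟩
          π 0R A (suc k) (liftAt (toℕ i')) ≡⟨ π-liftAt (toℕ i') ⟩
          vtxAt W (toℕ i')                 ≡⟨ vtxAt-toℕ W i' ⟩
          vtx W i'                         ∎

    liftWalk-isCycle : ¬ Repeating K W → IsCycle liftWalk
    liftWalk-isCycle ¬rep i i' eq with <-cmp i i'
    ... | tri< i<i' _ _ = ⊥-elim (¬rep (liftAt-repeats i<i' eq))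
    ... | tri≈ _ i≡i' _ = i≡i'
    ... | tri> _ _ i>i' = ⊥-elim (¬rep (liftAt-repeats i>i' (sym eq)))

proposition3 : {R : Set} (0R : R) (n m : ℕ) (A : Fin n → Fin m → R) (j k : ℕ) →
    1 ≤ j → 1 ≤ k →
    (W : ClosedWalk (ΓEdge 0R A) (2 * j * k)) →
    Repeating (2 * k) W ⇔
      (¬ (∃ λ (L : ClosedWalk (GEdge 0R A k) (2 * j * k)) →
            IsCycle L × SameClosedWalkVia (π 0R A k) L W))
proposition3 0R n m A (suc j) (suc k) (s≤s z≤n) (s≤s z≤n) W = mk⇔
  (λ rep (L , cycle , same) → isCycle⇒¬repeating 0R A {k} W L cycle same rep)
  (λ noCycleLift → decidable-stable (repeating? (≡-dec _≟_ _≟_) (2 * suc k) W)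
    λ ¬rep → noCycleLift (liftWalk , liftWalk-isCycle ¬rep , liftWalk-same))
  where
    open Lift 0R A (*-pres-∣ (m∣m*n {2} (suc j)) (∣-refl {suc k})) W
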